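{- (Blow-Up Lemma) Let $u$ be a vertex of a graph $G$ and let $H$ be a graph. If $G$ is ${\cal D}$ for the Maker-Breaker total domination game, then $G_u[H]$ is also ${\cal D}$.
   Context: The Maker-Breaker total domination game on a graph is played by Dominator and Staller, who alternately select a vertex not selected before. Dominator wins if at some point the set of vertices he has selected is a total dominating set (every vertex of the graph has a neighbour in it); otherwise Staller wins. A graph is ${\cal D}$ if Dominator has a winning strategy both when he moves first and when Staller moves first. For a vertex $u$ of $G$ and a graph $H$ disjoint from $G$, $G_u[H]$ is the graph obtained from $G$ by replacing $u$ with $H$ and joining every vertex of $H$ by an edge to every vertex of $N_G(u)$. -}

module Defs where

open import Data.Nat using (ℕ; suc; _+_)
open import Data.Fin using (Fin; punchIn; splitAt)
open import Data.Fin.Subset using (Subset; _∈_; _∉_; _∪_; ⁅_⁆; ⊥)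
open import Data.Bool using (Bool; true; false; T)
open import Data.Sum using (_⊎_; inj₁; inj₂)
open import Data.Product using (_×_; ∃; Σ)
open import Relation.Binary.PropositionalEquality using (_≡_; refl)

record Graph (n : ℕ) : Set where
  field
    adj    : Fin n → Fin n → Bool
    sym    : ∀ x y → adj x y ≡ adj y x
    irrefl : ∀ x → adj x x ≡ false

open Graph public

Adj : ∀ {n} → Graph n → Fin n → Fin n → Set
Adj G x y = T (adj G x y)

TotDom : ∀ {n} → Graph n → Subset n → Set
TotDom {n} G D = ∀ (v : Fin n) → ∃ λ (w : Fin n) → w ∈ D × Adj G v w

Free : ∀ {n} → Subset n → Subset n → Fin n → Set
Free D S v = v ∉ D × v ∉ S

-- Positions of the Maker-Breaker total domination game: D = vertices
-- chosen by Dominator, S = vertices chosen by Staller.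
-- DomWinsD G D S : Dominator (to move) has a winning strategy.
-- DomWinsS G D S : Staller is to move and Dominator has a winning strategy.
-- Dominator wins as soon as D is a total dominating set; if the board is
-- full (Staller has no move / Dominator has no move) before that, Staller wins.
mutual
  data DomWinsD {n : ℕ} (G : Graph n) (D S : Subset n) : Set where
    doneD : TotDom G D → DomWinsD G D S
    moveD : (v : Fin n) → Free D S v → DomWinsS G (D ∪ ⁅ v ⁆) S → DomWinsD G D S

  data DomWinsS {n : ℕ} (G : Graph n) (D S : Subset n) : Set where
    doneS : TotDom G D → DomWinsS G D S
    moveS : (∃ λ (v : Fin n) → Free D S v)
          → (∀ (v : Fin n) → Free D S v → DomWinsD G D (S ∪ ⁅ v ⁆))
          → DomWinsS G D S

IsD : ∀ {n} → Graph n → Set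
IsD G = DomWinsD G ⊥ ⊥ × DomWinsS G ⊥ ⊥

-- G has vertex set Fin (suc k), u : Fin (suc k); the
-- vertices of G other than u are punchIn u i (i : Fin k); H has vertex set
-- Fin m.  The vertex set of G_u[H] is Fin (k + m): the first k are the
-- vertices of G - u, the last m are those of H.
blowAdj⊎ : ∀ {k m} → Graph (suc k) → Fin (suc k) → Graph m
         → Fin k ⊎ Fin m → Fin k ⊎ Fin m → Bool
blowAdj⊎ G u H (inj₁ i) (inj₁ j) = adj G (punchIn u i) (punchIn u j)
blowAdj⊎ G u H (inj₁ i) (inj₂ h) = adj G (punchIn u i) u
blowAdj⊎ G u H (inj₂ h) (inj₁ j) = adj G u (punchIn u j)
blowAdj⊎ G u H (inj₂ h) (inj₂ h′) = adj H h h′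

blowSym⊎ : ∀ {k m} (G : Graph (suc k)) (u : Fin (suc k)) (H : Graph m) x y
         → blowAdj⊎ G u H x y ≡ blowAdj⊎ G u H y x
blowSym⊎ G u H (inj₁ i) (inj₁ j) = sym G (punchIn u i) (punchIn u j)
blowSym⊎ G u H (inj₁ i) (inj₂ h) = sym G (punchIn u i) u
blowSym⊎ G u H (inj₂ h) (inj₁ j) = sym G u (punchIn u j)
blowSym⊎ G u H (inj₂ h) (inj₂ h′) = sym H h h′

blowIrr⊎ : ∀ {k m} (G : Graph (suc k)) (u : Fin (suc k)) (H : Graph m) x
         → blowAdj⊎ G u H x x ≡ false
blowIrr⊎ G u H (inj₁ i) = irrefl G (punchIn u i)
blowIrr⊎ G u H (inj₂ h) = irrefl H h

blowUp : ∀ {k m} → Graph (suc k) → Fin (suc k) → Graph m → Graph (k + m)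
blowUp {k} G u H = record
  { adj    = λ x y → blowAdj⊎ G u H (splitAt k x) (splitAt k y)
  ; sym    = λ x y → blowSym⊎ G u H (splitAt k x) (splitAt k y)
  ; irrefl = λ x → blowIrr⊎ G u H (splitAt k x)
  }

-- Collapsing H onto u is a surjection φ from G_u[H] onto G such that vertices
-- with adjacent images are adjacent.  Dominator plays on G_u[H] by shadowing a
-- winning strategy on G: a move v of the strategy is played on a free preimage
-- of v if there is one, and otherwise v already has a preimage in Dominator's
-- set; a Staller move y is read as the move φ y on G, and if φ y is already
-- taken Dominator spends a spare move.  Throughout, every vertex chosen on G by
-- Dominator has a preimage chosen on G_u[H], so a total dominating set reached
-- on G lifts to one on G_u[H].  If the board of G_u[H] fills up first, every
-- vertex of G not taken by Staller has a preimage chosen by Dominator, which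
-- suffices because a winning position is already dominated by Dominator's set
-- together with the vertices Staller has not taken.
module Submission where

open import Defs hiding (sym)
open import Data.Nat using (ℕ; suc; zero; _+_; _<_; _≤_)
open import Data.Nat.Properties using (≤-refl; ≤-pred; <-≤-trans; <⇒≤)
open import Data.Fin using (Fin; zero; punchIn; punchOut; splitAt; _↑ˡ_; _↑ʳ_; _≟_)
open import Data.Fin.Properties using (any?; splitAt-↑ˡ; splitAt-↑ʳ; punchIn-punchOut)
open import Data.Fin.Subset using (Subset; _∈_; _∉_; _∪_; ⁅_⁆; ⊥; ∁; ∣_∣; _⊂_)
open import Data.Fin.Subset.Properties
  using (_∈?_; ∉⊥; x∈⁅x⁆; x∈⁅y⁆⇒x≡y; x∈p∪q⁻; x∈p∪q⁺; p⊆p∪q; ∪-assoc; ∪-comm; p⊂q⇒∣p∣<∣q∣; p⊂q⇒∁p⊃∁q)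
open import Data.Bool using (T)
open import Data.Sum using (_⊎_; inj₁; inj₂; [_,_]; map₁; map₂)
open import Data.Product using (∃; _×_; _,_; proj₁; proj₂)
open import Data.Empty using (⊥-elim)
open import Function using (_∘_; const)
open import Relation.Nullary using (Dec; yes; no; ¬_; ¬?)
open import Relation.Nullary.Decidable using (_×-dec_)
open import Relation.Binary.PropositionalEquality using (_≡_; refl; sym; trans; cong; subst; module ≡-Reasoning)

x∈p∪⁅y⁆⁻ : ∀ {n} {x : Fin n} (p : Subset n) (y : Fin n) → x ∈ p ∪ ⁅ y ⁆ → x ∈ p ⊎ x ≡ y
x∈p∪⁅y⁆⁻ p y = map₂ (x∈⁅y⁆⇒x≡y y) ∘ x∈p∪q⁻ p ⁅ y ⁆

y∈p∪⁅y⁆ : ∀ {n} (p : Subset n) (y : Fin n) → y ∈ p ∪ ⁅ y ⁆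
y∈p∪⁅y⁆ p y = x∈p∪q⁺ (inj₂ (x∈⁅x⁆ y))

x∉p⇒p⊂p∪⁅x⁆ : ∀ {n} {x : Fin n} {p : Subset n} → x ∉ p → p ⊂ p ∪ ⁅ x ⁆
x∉p⇒p⊂p∪⁅x⁆ {x = x} {p} x∉p = p⊆p∪q ⁅ x ⁆ , x , y∈p∪⁅y⁆ p x , x∉p

free? : ∀ {n} (A B : Subset n) (y : Fin n) → Dec (Free A B y)
free? A B y = ¬? (y ∈? A) ×-dec ¬? (y ∈? B)

unclaimed : ∀ {n} → Subset n → Subset n → ℕ
unclaimed A B = ∣ ∁ (A ∪ B) ∣

x∉p⇒∣∁p∪⁅x⁆∣<∣∁p∣ : ∀ {n} {x : Fin n} {p : Subset n} → x ∉ p → ∣ ∁ (p ∪ ⁅ x ⁆) ∣ < ∣ ∁ p ∣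
x∉p⇒∣∁p∪⁅x⁆∣<∣∁p∣ = p⊂q⇒∣p∣<∣q∣ ∘ p⊂q⇒∁p⊃∁q ∘ x∉p⇒p⊂p∪⁅x⁆

module _ {n : ℕ} {A B : Subset n} {y : Fin n} (free : Free A B y) where

  private
    y∉A∪B : y ∉ A ∪ B
    y∉A∪B = [ proj₁ free , proj₂ free ] ∘ x∈p∪q⁻ A B

  unclaimed-claimᴰ : unclaimed (A ∪ ⁅ y ⁆) B < unclaimed A B
  unclaimed-claimᴰ = subst (λ C → ∣ ∁ C ∣ < unclaimed A B) (sym reorder) (x∉p⇒∣∁p∪⁅x⁆∣<∣∁p∣ y∉A∪B)
    where
    open ≡-Reasoning
    reorder : (A ∪ ⁅ y ⁆) ∪ B ≡ (A ∪ B) ∪ ⁅ y ⁆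
    reorder = begin
      (A ∪ ⁅ y ⁆) ∪ B  ≡⟨ ∪-assoc A ⁅ y ⁆ B ⟩
      A ∪ (⁅ y ⁆ ∪ B)  ≡⟨ cong (A ∪_) (∪-comm ⁅ y ⁆ B) ⟩
      A ∪ (B ∪ ⁅ y ⁆)  ≡⟨ sym (∪-assoc A B ⁅ y ⁆) ⟩
      (A ∪ B) ∪ ⁅ y ⁆  ∎

  unclaimed-claimˢ : unclaimed A (B ∪ ⁅ y ⁆) < unclaimed A B
  unclaimed-claimˢ = subst (λ C → ∣ ∁ C ∣ < unclaimed A B) (∪-assoc A B ⁅ y ⁆) (x∉p⇒∣∁p∪⁅x⁆∣<∣∁p∣ y∉A∪B)

Dominates : ∀ {n} → Graph n → (Fin n → Set) → Set
Dominates {n} G P = ∀ (v : Fin n) → ∃ λ (w : Fin n) → P w × Adj G v w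

dominates-mono : ∀ {n} (G : Graph n) {P Q : Fin n → Set}
               → (∀ {w} → P w → Q w) → Dominates G P → Dominates G Q
dominates-mono G P⇒Q dom v with dom v
... | w , Pw , v~w = w , P⇒Q Pw , v~w

mutual
  winsᴰ-dominates : ∀ {n} {G : Graph n} {D S : Subset n}
                  → DomWinsD G D S → Dominates G (λ w → w ∈ D ⊎ w ∉ S)
  winsᴰ-dominates {G = G} (doneD td) = dominates-mono G inj₁ td
  winsᴰ-dominates {G = G} {D} {S} (moveD v (_ , v∉S) d) = dominates-mono G unclaim (winsˢ-dominates d)
    where
    unclaim : ∀ {w} → w ∈ D ∪ ⁅ v ⁆ ⊎ w ∉ S → w ∈ D ⊎ w ∉ S
    unclaim (inj₁ w∈D∪v) with x∈p∪⁅y⁆⁻ D v w∈D∪v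
    ... | inj₁ w∈D = inj₁ w∈D
    ... | inj₂ refl = inj₂ v∉S
    unclaim (inj₂ w∉S) = inj₂ w∉S

  winsˢ-dominates : ∀ {n} {G : Graph n} {D S : Subset n}
                  → DomWinsS G D S → Dominates G (λ w → w ∈ D ⊎ w ∉ S)
  winsˢ-dominates {G = G} (doneS td) = dominates-mono G inj₁ td
  winsˢ-dominates {G = G} (moveS (w , w-free) h) =
    dominates-mono G (map₂ (_∘ p⊆p∪q ⁅ w ⁆)) (winsᴰ-dominates (h w w-free))

module Shadowing {n n′ : ℕ} (G : Graph n) (G′ : Graph n′) (φ : Fin n′ → Fin n)
                 (φ-onto : ∀ x → ∃ λ y → φ y ≡ x)
                 (adj-reflect : ∀ y y′ → Adj G (φ y) (φ y′) → Adj G′ y y′) where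

  Covers : Subset n′ → Fin n → Set
  Covers A x = ∃ λ y → y ∈ A × φ y ≡ x

  covers-∪ : ∀ {A x} y → Covers A x → Covers (A ∪ ⁅ y ⁆) x
  covers-∪ {A} y (z , z∈A , φz≡x) = z , p⊆p∪q ⁅ y ⁆ z∈A , φz≡x

  dominates-lift : ∀ {A} → Dominates G (Covers A) → TotDom G′ A
  dominates-lift dom v with dom (φ v)
  ... | _ , (y , y∈A , refl) , φv~φy = y , y∈A , adj-reflect v y φv~φy

  record Shadows (D S : Subset n) (A B : Subset n′) : Set where
    field
      covers-D  : ∀ {x} → x ∈ D → Covers A x
      accounted : ∀ {y} → y ∈ B → φ y ∈ S ⊎ Covers A (φ y)
  open Shadows

  shadows-start : Shadows ⊥ ⊥ ⊥ ⊥
  shadows-start = record { covers-D = ⊥-elim ∘ ∉⊥ ; accounted = ⊥-elim ∘ ∉⊥ }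

  shadows-totDom : ∀ {D S A B} → Shadows D S A B → TotDom G D → TotDom G′ A
  shadows-totDom sh = dominates-lift ∘ dominates-mono G (covers-D sh)

  shadows-spare : ∀ {D S A B} y → Shadows D S A B → Shadows D S (A ∪ ⁅ y ⁆) B
  shadows-spare y sh = record
    { covers-D  = covers-∪ y ∘ covers-D sh
    ; accounted = map₂ (covers-∪ y) ∘ accounted sh }

  shadows-claimᴰ : ∀ {D S A B v} → Covers A v → Shadows D S A B → Shadows (D ∪ ⁅ v ⁆) S A B
  shadows-claimᴰ {D} {v = v} cv sh = record { covers-D = covers ; accounted = accounted sh }
    where
    covers : ∀ {x} → x ∈ D ∪ ⁅ v ⁆ → Covers _ x
    covers x∈D∪v with x∈p∪⁅y⁆⁻ D v x∈D∪v
    ... | inj₁ x∈D = covers-D sh x∈D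
    ... | inj₂ refl = cv

  shadows-claimˢ : ∀ {D S A B y} → φ y ∈ S ⊎ Covers A (φ y) → Shadows D S A B
                 → Shadows D S A (B ∪ ⁅ y ⁆)
  shadows-claimˢ {B = B} {y} acc sh = record { covers-D = covers-D sh ; accounted = accounted′ }
    where
    accounted′ : ∀ {z} → z ∈ B ∪ ⁅ y ⁆ → φ z ∈ _ ⊎ Covers _ (φ z)
    accounted′ z∈B∪y with x∈p∪⁅y⁆⁻ B y z∈B∪y
    ... | inj₁ z∈B = accounted sh z∈B
    ... | inj₂ refl = acc

  shadows-extendˢ : ∀ {D S A B} v → Shadows D S A B → Shadows D (S ∪ ⁅ v ⁆) A B
  shadows-extendˢ v sh = record
    { covers-D  = covers-D sh
    ; accounted = map₁ (p⊆p∪q ⁅ v ⁆) ∘ accounted sh }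

  covered-or-free : ∀ {D S A B x} → Shadows D S A B → x ∉ S
                  → Covers A x ⊎ ∃ λ y → φ y ≡ x × Free A B y
  covered-or-free {A = A} {B} {x} sh x∉S with φ-onto x
  ... | y , refl with y ∈? A | y ∈? B
  ...   | yes y∈A | _        = inj₁ (y , y∈A , refl)
  ...   | no y∉A  | no y∉B   = inj₂ (y , refl , y∉A , y∉B)
  ...   | no _    | yes y∈B  with accounted sh y∈B
  ...     | inj₁ φy∈S = ⊥-elim (x∉S φy∈S)
  ...     | inj₂ cov  = inj₁ cov

  cornered : ∀ {D S A B} → Shadows D S A B → ¬ (∃ (Free A B)) → DomWinsS G D S → TotDom G′ A
  cornered {S = S} sh full d = dominates-lift (dominates-mono G covers (winsˢ-dominates d))
    where
    covers : ∀ {x} → x ∈ _ ⊎ x ∉ S → Covers _ x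
    covers (inj₁ x∈D) = covers-D sh x∈D
    covers (inj₂ x∉S) with covered-or-free sh x∉S
    ... | inj₁ cov = cov
    ... | inj₂ (y , _ , y-free) = ⊥-elim (full (y , y-free))

  -- Fuel bounds the number of unclaimed vertices of G′: a step that advances
  -- only the game on G costs fuel without claiming a vertex of G′.
  mutual
    liftᴰ : ∀ {D S A B} fuel → unclaimed A B < fuel
          → DomWinsD G D S → Shadows D S A B → DomWinsD G′ A B
    liftᴰ _ _ (doneD td) sh = doneD (shadows-totDom sh td)
    liftᴰ zero () (moveD _ _ _) _
    liftᴰ {A = A} {B} (suc fuel) lt (moveD v (_ , v∉S) d) sh
      with any? (λ y → (φ y ≟ v) ×-dec free? A B y)
    ... | yes (y , refl , y-free) =
      moveD y y-free (liftˢ fuel (<-≤-trans (unclaimed-claimᴰ y-free) (≤-pred lt))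
                             d (shadows-claimᴰ (y , y∈p∪⁅y⁆ A y , refl) (shadows-spare y sh)))
    ... | no no-free-preimage = liftˢᴰ fuel (≤-pred lt) d (shadows-claimᴰ v-covered sh)
      where
      v-covered : Covers A v
      v-covered with covered-or-free sh v∉S
      ... | inj₁ cov = cov
      ... | inj₂ (y , φy≡v , y-free) = ⊥-elim (no-free-preimage (y , φy≡v , y-free))

    liftˢ : ∀ {D S A B} fuel → unclaimed A B < fuel
          → DomWinsS G D S → Shadows D S A B → DomWinsS G′ A B
    liftˢ _ _ (doneS td) sh = doneS (shadows-totDom sh td)
    liftˢ zero () (moveS _ _) _
    liftˢ {A = A} {B} (suc fuel) lt d@(moveS _ _) sh with any? (free? A B)
    ... | yes some-free = moveS some-free (reply fuel (≤-pred lt) d sh)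
    ... | no none-free = doneS (cornered sh none-free d)

    liftˢᴰ : ∀ {D S A B} fuel → unclaimed A B ≤ fuel
           → DomWinsS G D S → Shadows D S A B → DomWinsD G′ A B
    liftˢᴰ {A = A} {B} fuel le d sh with any? (free? A B)
    ... | yes (y , y-free) =
      moveD y y-free (liftˢ fuel (<-≤-trans (unclaimed-claimᴰ y-free) le) d (shadows-spare y sh))
    ... | no none-free = doneD (cornered sh none-free d)

    reply : ∀ {D S A B} fuel → unclaimed A B ≤ fuel
          → DomWinsS G D S → Shadows D S A B
          → ∀ y → Free A B y → DomWinsD G′ A (B ∪ ⁅ y ⁆)
    reply _ _ (doneS td) sh _ _ = doneD (shadows-totDom sh td)
    reply {D} {S} fuel le d@(moveS _ h) sh y y-free with φ y ∈? D | φ y ∈? S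
    ... | yes φy∈D | _ =
      liftˢᴰ fuel (<⇒≤ (<-≤-trans (unclaimed-claimˢ y-free) le)) d
             (shadows-claimˢ (inj₂ (covers-D sh φy∈D)) sh)
    ... | no _ | yes φy∈S =
      liftˢᴰ fuel (<⇒≤ (<-≤-trans (unclaimed-claimˢ y-free) le)) d
             (shadows-claimˢ (inj₁ φy∈S) sh)
    ... | no φy∉D | no φy∉S =
      liftᴰ fuel (<-≤-trans (unclaimed-claimˢ y-free) le) (h (φ y) (φy∉D , φy∉S))
            (shadows-claimˢ (inj₁ (y∈p∪⁅y⁆ S (φ y))) (shadows-extendˢ (φ y) sh))

  isD-lift : IsD G → IsD G′
  isD-lift (first , second) =
    liftᴰ _ ≤-refl first shadows-start , liftˢ _ ≤-refl second shadows-start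

module Collapse {k m : ℕ} (G : Graph (suc k)) (u : Fin (suc k)) (H : Graph (suc m)) where

  collapse⊎ : Fin k ⊎ Fin (suc m) → Fin (suc k)
  collapse⊎ = [ punchIn u , const u ]

  collapse : Fin (k + suc m) → Fin (suc k)
  collapse = collapse⊎ ∘ splitAt k

  collapse⊎-reflects-adj : ∀ a b → T (adj G (collapse⊎ a) (collapse⊎ b)) → T (blowAdj⊎ G u H a b)
  collapse⊎-reflects-adj (inj₁ _) (inj₁ _) adjacent = adjacent
  collapse⊎-reflects-adj (inj₁ _) (inj₂ _) adjacent = adjacent
  collapse⊎-reflects-adj (inj₂ _) (inj₁ _) adjacent = adjacent
  collapse⊎-reflects-adj (inj₂ _) (inj₂ _) loop = ⊥-elim (subst T (irrefl G u) loop)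

  collapse-reflects-adj : ∀ x y → Adj G (collapse x) (collapse y) → Adj (blowUp G u H) x y
  collapse-reflects-adj x y = collapse⊎-reflects-adj (splitAt k x) (splitAt k y)

  collapse-onto : ∀ v → ∃ λ x → collapse x ≡ v
  collapse-onto v with v ≟ u
  ... | yes refl = k ↑ʳ zero , cong collapse⊎ (splitAt-↑ʳ k (suc m) zero)
  ... | no v≢u   = punchOut u≢v ↑ˡ suc m ,
                   trans (cong collapse⊎ (splitAt-↑ˡ k (punchOut u≢v) (suc m))) (punchIn-punchOut u≢v)
    where u≢v = v≢u ∘ sym

lemma2p5 : ∀ {k m : ℕ} (G : Graph (suc k)) (u : Fin (suc k)) (H : Graph (suc m))
         → IsD G → IsD (blowUp G u H)
lemma2p5 G u H = Shadowing.isD-lift G (blowUp G u H) collapse collapse-onto collapse-reflects-adj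
  where open Collapse G u H
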